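{- Let $Q$ be a quiver with a finite forkless part. If $Q'$ is a disconnected full subquiver of $Q$, then $Q'$ is mutation-finite.
   Context: A quiver is a finite directed multigraph with no loops and no 2-cycles; $q_{ij}$ is the number of arrows $i\to j$ if positive and minus the number of arrows $j\to i$ otherwise. Mutation $\mu_v$: $q'_{ab}=-q_{ab}$ if $v\in\{a,b\}$, else $q'_{ab}=q_{ab}+\max(q_{av},0)\max(q_{vb},0)-\max(q_{bv},0)\max(q_{va},0)$. The labelled mutation class $[Q]$ is the set of quivers on the same vertex set obtainable from $Q$ by mutations; $Q$ is mutation-finite if $[Q]$ is finite. A full subquiver is induced on a vertex subset; it is disconnected if its underlying undirected graph is disconnected. Abundant: at least two arrows between every pair of distinct vertices; acyclic: no directed cycle; $Q^+(v)=\{j:q_{vj}>0\}$, $Q^-(v)=\{j:q_{jv}>0\}$. A fork is an abundant, non-acyclic quiver $F$ with a vertex $r$ such that for all $i\in F^-(r)$, $j\in F^+(r)$: $f_{ji}>f_{ir}$ and $f_{ji}>f_{rj}$, and the full subquivers on $F^-(r)$ and $F^+(r)$ are acyclic. $Q$ has a finite forkless part if $[Q]$ contains only finitely many quivers that are not forks. -}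

module Defs where

open import Data.Nat using (ℕ)
open import Data.Integer using (ℤ; 0ℤ; -_; _+_; _-_; _*_; _⊔_; _<_; _≤_; ∣_∣; +_)
open import Data.Fin using (Fin; _≟_)
open import Data.Bool using (Bool; true; false)
open import Data.Product using (Σ; ∃; _×_; _,_)
open import Data.Sum using (_⊎_)
open import Data.Unit using (⊤)
open import Data.List using (List)
open import Data.List.Membership.Propositional using (_∈_)
open import Data.List.Relation.Unary.Any using (Any)
open import Relation.Nullary using (¬_; yes; no)
open import Relation.Binary.PropositionalEquality using (_≡_; _≢_)
open import Function.Definitions using (Injective)

-- A quiver on vertex set Fin n is encoded by its exchange matrix q : Fin n → Fin n → ℤ,
-- q i j = number of arrows i → j if positive, minus number of arrows j → i otherwise.
Mat : ℕ → Set
Mat n = Fin n → Fin n → ℤ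

-- No loops and no 2-cycles: the matrix is skew-symmetric.
IsQuiver : ∀ {n} → Mat n → Set
IsQuiver {n} q = ∀ (i j : Fin n) → q i j ≡ - q j i

pos : ℤ → ℤ
pos x = x ⊔ 0ℤ

mutate : ∀ {n} → Fin n → Mat n → Mat n
mutate v q a b with a ≟ v | b ≟ v
... | yes _ | _     = - q a b
... | no _  | yes _ = - q a b
... | no _  | no _  = q a b + pos (q a v) * pos (q v b) - pos (q b v) * pos (q v a)

data MutClass {n} (q : Mat n) : Mat n → Set where
  here : MutClass q q
  step : ∀ {q'} (v : Fin n) → MutClass q q' → MutClass q (mutate v q')

_≐_ : ∀ {n} → Mat n → Mat n → Set
q ≐ r = ∀ i j → q i j ≡ r i j

MutationFinite : ∀ {n} → Mat n → Set
MutationFinite {n} q =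
  Σ (List (Mat n)) λ L → ∀ q' → MutClass q q' → Any (λ r → q' ≐ r) L

data Walk {n} (q : Mat n) (P : Fin n → Set) : Fin n → Fin n → Set where
  edge : ∀ {x y} → P x → P y → 0ℤ < q x y → Walk q P x y
  cons : ∀ {x y z} → P x → 0ℤ < q x y → Walk q P y z → Walk q P x z

HasCycleIn : ∀ {n} → Mat n → (Fin n → Set) → Set
HasCycleIn q P = ∃ λ x → Walk q P x x

AcyclicOn : ∀ {n} → Mat n → (Fin n → Set) → Set
AcyclicOn q P = ¬ HasCycleIn q P

Acyclic : ∀ {n} → Mat n → Set
Acyclic q = AcyclicOn q (λ _ → ⊤)

Abundant : ∀ {n} → Mat n → Set
Abundant {n} q = ∀ (i j : Fin n) → i ≢ j → 2 Data.Nat.≤ ∣ q i j ∣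
  where import Data.Nat

In⁻ : ∀ {n} → Mat n → Fin n → Fin n → Set
In⁻ q r i = 0ℤ < q i r

Out⁺ : ∀ {n} → Mat n → Fin n → Fin n → Set
Out⁺ q r j = 0ℤ < q r j

IsForkWithPoint : ∀ {n} → Mat n → Fin n → Set
IsForkWithPoint {n} f r =
  (∀ (i j : Fin n) → In⁻ f r i → Out⁺ f r j → (f i r < f j i) × (f r j < f j i))
  × AcyclicOn f (In⁻ f r)
  × AcyclicOn f (Out⁺ f r)

IsFork : ∀ {n} → Mat n → Set
IsFork {n} f = Abundant f × ¬ Acyclic f × Σ (Fin n) (IsForkWithPoint f)

FiniteForklessPart : ∀ {n} → Mat n → Set
FiniteForklessPart {n} q =
  Σ (List (Mat n)) λ L → ∀ q' → MutClass q q' → ¬ IsFork q' → Any (λ r → q' ≐ r) L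

-- Full subquiver on the image of an injective map ι : Fin m → Fin n.
restrict : ∀ {m n} → Mat n → (Fin m → Fin n) → Mat m
restrict q ι i j = q (ι i) (ι j)

Disconnected : ∀ {m} → Mat m → Set
Disconnected {m} q =
  Σ (Fin m → Bool) λ c →
    (∃ λ i → c i ≡ true) × (∃ λ j → c j ≡ false) ×
    (∀ i j → c i ≡ true → c j ≡ false → q i j ≡ 0ℤ)

{-# OPTIONS --safe #-}
-- Colour the vertices of the subquiver so that no arrows join different colours.
-- Mutation at a vertex v only changes the entry (a, b) through paths a → v → b or
-- b → v → a, and v has the colour of at most one of a, b; so every quiver in the
-- mutation class of the subquiver is still disconnected along the same colouring.
-- Mutations of the subquiver lift to mutations of Q at the same vertices, and the
-- lifted quivers contain a pair of distinct vertices with no arrows between them,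
-- so they are not abundant and hence not forks. They therefore lie in the finite
-- forkless part of [Q], and restricting that finite list covers [Q'].
module Submission where

open import Defs
open import Data.Nat using (ℕ)
open import Data.Integer using (0ℤ; -_)
open import Data.Integer.Properties using (*-zeroˡ; *-zeroʳ)
open import Data.Bool using (true; false) renaming (_≟_ to _≟ᵇ_)
open import Data.Fin using (Fin; _≟_)
open import Data.Product using (Σ; _×_; _,_)
open import Data.Sum using (_⊎_; inj₁; inj₂)
open import Data.Empty using (⊥-elim)
open import Data.List using (map)
open import Data.List.Relation.Unary.Any using (Any; here; there)
open import Function.Definitions using (Injective)
open import Relation.Nullary using (¬_; yes; no)
open import Relation.Binary.Definitions using (DecidableEquality)
open import Relation.Binary.PropositionalEquality using (_≡_; _≢_; refl; sym; trans; cong)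

NonAdjacent : ∀ {n} → Mat n → Fin n → Fin n → Set
NonAdjacent q a b = (q a b ≡ 0ℤ) × (q b a ≡ 0ℤ)

mutate-preserves-zero : ∀ {n} (q : Mat n) (v a b : Fin n) →
  NonAdjacent q a v ⊎ NonAdjacent q v b →
  q a b ≡ 0ℤ → mutate v q a b ≡ 0ℤ
mutate-preserves-zero q v a b apart qab≡0 with a ≟ v | b ≟ v | apart
... | yes _ | _     | _ rewrite qab≡0 = refl
... | no _  | yes _ | _ rewrite qab≡0 = refl
... | no _  | no _  | inj₁ (qav≡0 , qva≡0)
  rewrite qab≡0 | qav≡0 | qva≡0 | *-zeroˡ (pos (q v b)) | *-zeroʳ (pos (q b v)) = refl
... | no _  | no _  | inj₂ (qvb≡0 , qbv≡0)
  rewrite qab≡0 | qvb≡0 | qbv≡0 | *-zeroˡ (pos (q v a)) | *-zeroʳ (pos (q a v)) = refl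

module _ {A : Set} (_≟ᶜ_ : DecidableEquality A) {m : ℕ} (c : Fin m → A) where

  Separated : Mat m → Set
  Separated q = ∀ i j → c i ≢ c j → q i j ≡ 0ℤ

  mutate-preserves-separated : ∀ q v → Separated q → Separated (mutate v q)
  mutate-preserves-separated q v sep i j ci≢cj with c v ≟ᶜ c i
  ... | yes cv≡ci = mutate-preserves-zero q v i j
                      (inj₂ (sep v j cv≢cj , sep j v (λ e → cv≢cj (sym e))))
                      (sep i j ci≢cj)
    where cv≢cj : c v ≢ c j
          cv≢cj e = ci≢cj (trans (sym cv≡ci) e)
  ... | no cv≢ci = mutate-preserves-zero q v i j
                     (inj₁ (sep i v (λ e → cv≢ci (sym e)) , sep v i cv≢ci))
                     (sep i j ci≢cj)

  MutClass-preserves-separated : ∀ {q q'} → Separated q → MutClass q q' → Separated q'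
  MutClass-preserves-separated sep here        = sep
  MutClass-preserves-separated sep (step v mc) =
    mutate-preserves-separated _ v (MutClass-preserves-separated sep mc)

module _ {n m : ℕ} (ι : Fin m → Fin n) (ι-injective : Injective _≡_ _≡_ ι) where

  restrict-mutate : ∀ (Q : Mat n) (q : Mat m) v → restrict Q ι ≐ q →
    restrict (mutate (ι v) Q) ι ≐ mutate v q
  restrict-mutate Q q v eq a b with a ≟ v | ι a ≟ ι v
  ... | yes a≡v | no ιa≢ιv = ⊥-elim (ιa≢ιv (cong ι a≡v))
  ... | no a≢v  | yes ιa≡ιv = ⊥-elim (a≢v (ι-injective ιa≡ιv))
  ... | yes _   | yes _ = cong -_ (eq a b)
  ... | no _    | no _ with b ≟ v | ι b ≟ ι v
  ...   | yes b≡v | no ιb≢ιv = ⊥-elim (ιb≢ιv (cong ι b≡v))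
  ...   | no b≢v  | yes ιb≡ιv = ⊥-elim (b≢v (ι-injective ιb≡ιv))
  ...   | yes _   | yes _ = cong -_ (eq a b)
  ...   | no _    | no _ rewrite eq a b | eq a v | eq v b | eq b v | eq v a = refl

  lift-MutClass : ∀ (Q : Mat n) {q'} → MutClass (restrict Q ι) q' →
    Σ (Mat n) λ Q' → MutClass Q Q' × (restrict Q' ι ≐ q')
  lift-MutClass Q here = Q , here , λ _ _ → refl
  lift-MutClass Q (step v mc) with lift-MutClass Q mc
  ... | Q' , mcQ' , eq = mutate (ι v) Q' , step (ι v) mcQ' , restrict-mutate Q' _ v eq

  Any-restrict : ∀ {Q : Mat n} {q : Mat m} {L} → restrict Q ι ≐ q →
    Any (Q ≐_) L → Any (q ≐_) (map (λ r → restrict r ι) L)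
  Any-restrict eq (here Q≐r) = here λ i j → trans (sym (eq i j)) (Q≐r (ι i) (ι j))
  Any-restrict eq (there a)  = there (Any-restrict eq a)

zero-entry⇒¬IsFork : ∀ {n} (q : Mat n) {i j} → i ≢ j → q i j ≡ 0ℤ → ¬ IsFork q
zero-entry⇒¬IsFork q {i} {j} i≢j qij≡0 (abundant , _) with abundant i j i≢j
... | two≤∣qij∣ rewrite qij≡0 with two≤∣qij∣
... | ()

Disconnected⇒Separated : ∀ {m} {q : Mat m} → IsQuiver q → ((c , _) : Disconnected q) →
  Separated _≟ᵇ_ c q
Disconnected⇒Separated {q = q} isq (c , _ , _ , split) i j ci≢cj
  with c i in ci | c j in cj
... | true  | true  = ⊥-elim (ci≢cj refl)
... | false | false = ⊥-elim (ci≢cj refl)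
... | true  | false = split i j ci cj
... | false | true  = trans (isq i j) (cong -_ (split j i cj ci))

corollary3p7 : ∀ {n m : ℕ} (q : Mat n) → IsQuiver q → FiniteForklessPart q →
    (ι : Fin m → Fin n) → Injective _≡_ _≡_ ι →
    Disconnected (restrict q ι) → MutationFinite (restrict q ι)
corollary3p7 q isq (L , covers-forkless) ι ι-injective disc@(c , (i₀ , ci₀) , (j₀ , cj₀) , _) =
  map (λ r → restrict r ι) L , covers
  where
    separated : Separated _≟ᵇ_ c (restrict q ι)
    separated = Disconnected⇒Separated (λ i j → isq (ι i) (ι j)) disc

    ci₀≢cj₀ : c i₀ ≢ c j₀
    ci₀≢cj₀ e with trans (sym ci₀) (trans e cj₀)
    ... | ()

    covers : ∀ q' → MutClass (restrict q ι) q' → Any (q' ≐_) (map (λ r → restrict r ι) L)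
    covers q' mc with lift-MutClass ι ι-injective q mc
    ... | Q , mcQ , eq = Any-restrict ι ι-injective eq (covers-forkless Q mcQ Q-not-fork)
      where
        Q-not-fork : ¬ IsFork Q
        Q-not-fork = zero-entry⇒¬IsFork Q
          (λ e → ci₀≢cj₀ (cong c (ι-injective e)))
          (trans (eq i₀ j₀)
            (MutClass-preserves-separated _≟ᵇ_ c separated mc i₀ j₀ ci₀≢cj₀))
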